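{- Let $f:\{0,1\}^n\to\{0,1\}$ be a non-constant monotone Boolean function, and let $m$ be the maximal number of variables in a prime implicant of $f$. If $f$ can be computed by a monotone read-$k$ circuit $F$ of size $s$, then $f$ can also be computed by a monotone read-$k$ circuit $H$ of size at most $s\cdot O(k^2m^2)$ (with an absolute constant in the $O$) such that every vector $b\in B_H$ has degree $b_1+\dots+b_n\leq km$ (equivalently, the formal polynomial of $H$ has degree at most $km$).
   Context: A monotone Boolean circuit is a directed acyclic graph (parallel edges allowed) whose indegree-zero nodes hold variables among $x_1,\dots,x_n$ (no constants) and whose gates have indegree two and are labeled $\lor$ or $\land$; size = number of gates. The set $B_F\subseteq\mathbb{N}^n$ of exponent vectors produced by $F$ is defined inductively: $B_{x_i}=\{e_i\}$, $B_{G\lor H}=B_G\cup B_H$, $B_{G\land H}=\{b+c:b\in B_G,c\in B_H\}$; it is the set of exponent vectors of the formal polynomial of $F$, i.e. the polynomial produced (without cancellations) by the $(+,\times)$ circuit obtained by replacing $\lor$ by $+$ and $\land$ by $\times$. $\mathrm{supp}(a)=\{i:a_i\neq0\}$. $\mathrm{Low}(f)$ is the set of $a\in\{0,1\}^n$ with $f(a)=1$ and $f(b)=0$ for all $b\leq a$, $b\neq a$. A monotone circuit computing $f$ is read-$k$ if for every $a\in\mathrm{Low}(f)$ there is $b\in B_F$ with $\mathrm{supp}(b)=\mathrm{supp}(a)$ and $b_i\leq k$ for all $i$. -}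

module Defs where

open import Data.Nat using (ℕ; zero; suc; _+_; _*_; _≤_)
open import Data.Bool using (Bool; true; false; if_then_else_)
import Data.Bool as B
open import Data.Fin using (Fin; zero; suc; _≟_)
open import Data.Vec using (Vec; lookup; tabulate; zipWith; map; sum)
open import Data.Vec.Relation.Binary.Pointwise.Inductive using (Pointwise)
open import Data.Product using (Σ; ∃; _×_; _,_)
open import Data.Sum using (_⊎_)
open import Relation.Nullary using (¬_; does)
open import Relation.Binary.PropositionalEquality using (_≡_)
open import Function.Bundles using (_⇔_)

BoolFun : ℕ → Set
BoolFun n = Vec Bool n → Bool

_≤ᵇ_ : ∀ {n} → Vec Bool n → Vec Bool n → Set
a ≤ᵇ b = Pointwise B._≤_ a b

Monotone : ∀ {n} → BoolFun n → Set
Monotone f = ∀ a b → a ≤ᵇ b → f a B.≤ f b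

NonConstant : ∀ {n} → BoolFun n → Set
NonConstant f = (∃ λ a → f a ≡ true) × (∃ λ b → f b ≡ false)

Low : ∀ {n} → BoolFun n → Vec Bool n → Set
Low f a = f a ≡ true × (∀ b → b ≤ᵇ a → ¬ (b ≡ a) → f b ≡ false)

-- number of variables of the prime implicant corresponding to a ∈ Low(f)
ones : ∀ {n} → Vec Bool n → ℕ
ones a = sum (map (λ x → if x then 1 else 0) a)

MaxPrimeImplicantSize : ∀ {n} → BoolFun n → ℕ → Set
MaxPrimeImplicantSize f m =
  (∃ λ a → Low f a × ones a ≡ m) × (∀ a → Low f a → ones a ≤ m)

-- A program with s gates over n variables has s + n nodes, indexed by
-- Fin (s + n): in  P ▷ g  node zero is the newest gate g and node (suc i)
-- is node i of P; in the empty program the nodes are the variables.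

data Op : Set where
  OR AND : Op

Gate : ℕ → Set
Gate m = Op × Fin m × Fin m

data SLP (n : ℕ) : ℕ → Set where
  []  : SLP n 0
  _▷_ : ∀ {s} → SLP n s → Gate (s + n) → SLP n (suc s)

opEval : Op → Bool → Bool → Bool
opEval OR  x y = x B.∨ y
opEval AND x y = x B.∧ y

eval : ∀ {n s} → SLP n s → Vec Bool n → Fin (s + n) → Bool
eval []                    x i       = lookup x i
eval (P ▷ (op , l , r))    x zero    = opEval op (eval P x l) (eval P x r)
eval (P ▷ g)               x (suc i) = eval P x i

unit : ∀ {n} → Fin n → Vec ℕ n
unit i = tabulate (λ j → if does (j ≟ i) then 1 else 0)

InB : ∀ {n s} → SLP n s → Fin (s + n) → Vec ℕ n → Set
InB []                  i       b = b ≡ unit i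
InB (P ▷ (OR  , l , r)) zero    b = InB P l b ⊎ InB P r b
InB (P ▷ (AND , l , r)) zero    b =
  Σ (Vec ℕ _) λ c → Σ (Vec ℕ _) λ d → InB P l c × InB P r d × b ≡ zipWith _+_ c d
InB (P ▷ g)             (suc i) b = InB P i b

record Circuit (n : ℕ) : Set where
  constructor circuit
  field
    size   : ℕ
    prog   : SLP n size
    output : Fin (size + n)

open Circuit public

B : ∀ {n} → Circuit n → Vec ℕ n → Set
B F b = InB (prog F) (output F) b

Computes : ∀ {n} → Circuit n → BoolFun n → Set
Computes F f = ∀ x → eval (prog F) x (output F) ≡ f x

SameSupp : ∀ {n} → Vec ℕ n → Vec Bool n → Set
SameSupp b a = ∀ i → (lookup b i ≡ 0) ⇔ (lookup a i ≡ false)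

ReadK : ∀ {n} → ℕ → Circuit n → BoolFun n → Set
ReadK k F f = ∀ a → Low f a →
  ∃ λ b → B F b × SameSupp b a × (∀ i → lookup b i ≤ k)

degree : ∀ {n} → Vec ℕ n → ℕ
degree b = sum b

module Submission where

-- Homogenise F up to degree D = k·m. For every node v and every d ≤ D build a node
-- producing the degree-d part of B_v: at an ∨-gate it is the ∨ of the inputs' parts,
-- at an ∧-gate the ∨ over j ≤ d of the ∧ of the inputs' parts of degrees j and d − j,
-- so each gate of F costs O(D²) new gates. The ∨ of the output's parts is a circuit H
-- with B_H = B_F ∩ {deg ≤ D}. A read-k witness of a prime implicant with at most m
-- variables has degree at most k·m, so H keeps all of them: H is read-k, and since
-- B_H ⊆ B_F it still computes f.

open import Defs

open import Data.Bool using (Bool; true; false; if_then_else_)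
import Data.Bool as Bool
import Data.Bool.Properties as Boolₚ
open import Data.Empty using (⊥-elim)
open import Data.Fin using (Fin; zero; suc; _≟_)
open import Data.Fin.Properties using (any?)
open import Data.Maybe using (Maybe; just; nothing)
open import Data.Nat as ℕ using (ℕ; zero; suc; _+_; _*_; _∸_; _≤_; _<_; z≤n; s≤s)
open import Data.Nat.Induction using (<-wellFounded)
open import Data.Nat.Properties hiding (_≟_)
open import Data.Nat.Tactic.RingSolver using (solve-∀)
open import Data.Product using (Σ; ∃; _×_; _,_; proj₁; proj₂)
open import Data.Sum using (_⊎_; inj₁; inj₂)
open import Data.Vec using (Vec; []; _∷_; lookup; tabulate; zipWith; sum; _[_]≔_)
open import Data.Vec.Properties using (lookup∘tabulate; lookup-zipWith)
open import Data.Vec.Relation.Binary.Pointwise.Inductive as Pointwise using ([]; _∷_)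
open import Function.Base using (_∘_)
open import Function.Bundles using (Equivalence; _⇔_)
open import Induction.WellFounded using (Acc; acc)
open import Level using (0ℓ)
open import Relation.Binary.PropositionalEquality
  using (_≡_; _≢_; refl; sym; trans; cong; cong₂; subst)
open import Relation.Nullary using (¬_; yes; no)
open import Relation.Nullary.Decidable using (dec-true; dec-false; _×-dec_)
open import Relation.Unary using (Pred; ∅; _∪_; _∩_; _⊆_; _≐_)
open import Relation.Unary.Properties using (≐-refl; ≐-sym; ≐-trans)
open import Algebra.Properties.CommutativeSemigroup +-commutativeSemigroup using (interchange)

Monomials : ℕ → Set₁
Monomials n = Pred (Vec ℕ n) 0ℓ

private variable
  n s t c c′ k m : ℕ
  a b x : Vec Bool n
  f : BoolFun n
  P Q R : SLP n s
  S S′ T T′ : Monomials n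
  A A′ : ∀ {t} → SLP n t → Set

lookup-unit-≡ : (i : Fin n) → lookup (unit i) i ≡ 1
lookup-unit-≡ i =
  trans (lookup∘tabulate _ i) (cong (λ c → if c then 1 else 0) (dec-true (i ≟ i) refl))

lookup-unit-≢ : (i j : Fin n) → j ≢ i → lookup (unit i) j ≡ 0
lookup-unit-≢ i j j≢i =
  trans (lookup∘tabulate _ j) (cong (λ c → if c then 1 else 0) (dec-false (j ≟ i) j≢i))

sum-zeros : ∀ n → sum (tabulate {n = n} (λ _ → 0)) ≡ 0
sum-zeros zero    = refl
sum-zeros (suc n) = sum-zeros n

degree-unit : (i : Fin n) → degree (unit i) ≡ 1
degree-unit {suc n} zero = cong suc (sum-zeros n)
degree-unit (suc i)      = degree-unit i

degree-zipWith-+ : (c d : Vec ℕ n) → degree (zipWith _+_ c d) ≡ degree c + degree d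
degree-zipWith-+ []      []      = refl
degree-zipWith-+ (x ∷ c) (y ∷ d) =
  trans (cong (x + y +_) (degree-zipWith-+ c d)) (interchange x y (sum c) (sum d))

1≤degree-InB : (P : SLP n s) (v : Fin (s + n)) {b : Vec ℕ n} → InB P v b → 1 ≤ degree b
1≤degree-InB []                  i       refl = ≤-reflexive (sym (degree-unit i))
1≤degree-InB (P ▷ (OR  , l , r)) zero    (inj₁ b∈l) = 1≤degree-InB P l b∈l
1≤degree-InB (P ▷ (OR  , l , r)) zero    (inj₂ b∈r) = 1≤degree-InB P r b∈r
1≤degree-InB (P ▷ (AND , l , r)) zero    (c , d , c∈l , _ , refl) =
  ≤-trans (1≤degree-InB P l c∈l) (≤-trans (m≤m+n _ _) (≤-reflexive (sym (degree-zipWith-+ c d))))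
1≤degree-InB (P ▷ (OR  , _ , _)) (suc v) b∈v = 1≤degree-InB P v b∈v
1≤degree-InB (P ▷ (AND , _ , _)) (suc v) b∈v = 1≤degree-InB P v b∈v

_⊨_ : Vec Bool n → Vec ℕ n → Set
x ⊨ b = ∀ i → lookup x i ≡ false → lookup b i ≡ 0

⊨-zipWith-+ : (x : Vec Bool n) (c d : Vec ℕ n) → x ⊨ zipWith _+_ c d → x ⊨ c × x ⊨ d
⊨-zipWith-+ x c d x⊨c+d =
    (λ i xᵢ → m+n≡0⇒m≡0 (lookup c i) (summand i xᵢ))
  , (λ i xᵢ → m+n≡0⇒n≡0 (lookup c i) (summand i xᵢ))
  where
  summand : ∀ i → lookup x i ≡ false → lookup c i + lookup d i ≡ 0
  summand i xᵢ = trans (sym (lookup-zipWith _+_ i c d)) (x⊨c+d i xᵢ)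

eval≡true⇒∃InB : (P : SLP n s) (x : Vec Bool n) (v : Fin (s + n)) →
  eval P x v ≡ true → ∃ λ b → InB P v b × x ⊨ b
eval≡true⇒∃InB [] x i xᵢ≡true = unit i , refl , λ j xⱼ≡false →
  lookup-unit-≢ i j λ { refl → true≢false (trans (sym xᵢ≡true) xⱼ≡false) }
  where true≢false : true ≢ false
        true≢false ()
eval≡true⇒∃InB (P ▷ (OR , l , r)) x zero e with eval P x l in el
... | true  = let b , b∈l , x⊨b = eval≡true⇒∃InB P x l el in b , inj₁ b∈l , x⊨b
... | false = let b , b∈r , x⊨b = eval≡true⇒∃InB P x r e in b , inj₂ b∈r , x⊨b
eval≡true⇒∃InB (P ▷ (AND , l , r)) x zero e with eval P x l in el | eval P x r in er
... | true | true =
  let c , c∈l , x⊨c = eval≡true⇒∃InB P x l el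
      d , d∈r , x⊨d = eval≡true⇒∃InB P x r er
  in zipWith _+_ c d , (c , d , c∈l , d∈r , refl) ,
     λ i xᵢ → trans (lookup-zipWith _+_ i c d) (cong₂ _+_ (x⊨c i xᵢ) (x⊨d i xᵢ))
eval≡true⇒∃InB (P ▷ (OR  , _ , _)) x (suc v) e = eval≡true⇒∃InB P x v e
eval≡true⇒∃InB (P ▷ (AND , _ , _)) x (suc v) e = eval≡true⇒∃InB P x v e

InB⇒eval≡true : (P : SLP n s) (x : Vec Bool n) (v : Fin (s + n)) {b : Vec ℕ n} →
  InB P v b → x ⊨ b → eval P x v ≡ true
InB⇒eval≡true [] x i refl x⊨b with lookup x i in xᵢ
... | true  = refl
... | false with trans (sym (lookup-unit-≡ i)) (x⊨b i xᵢ)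
...   | ()
InB⇒eval≡true (P ▷ (OR , l , r)) x zero (inj₁ b∈l) x⊨b
  rewrite InB⇒eval≡true P x l b∈l x⊨b = refl
InB⇒eval≡true (P ▷ (OR , l , r)) x zero (inj₂ b∈r) x⊨b
  rewrite InB⇒eval≡true P x r b∈r x⊨b = Boolₚ.∨-zeroʳ (eval P x l)
InB⇒eval≡true (P ▷ (AND , l , r)) x zero (c , d , c∈l , d∈r , refl) x⊨c+d
  rewrite InB⇒eval≡true P x l c∈l (proj₁ (⊨-zipWith-+ x c d x⊨c+d))
        | InB⇒eval≡true P x r d∈r (proj₂ (⊨-zipWith-+ x c d x⊨c+d))
  = refl
InB⇒eval≡true (P ▷ (OR  , _ , _)) x (suc v) b∈v x⊨b = InB⇒eval≡true P x v b∈v x⊨b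
InB⇒eval≡true (P ▷ (AND , _ , _)) x (suc v) b∈v x⊨b = InB⇒eval≡true P x v b∈v x⊨b

ones-[]≔false : (x : Vec Bool n) (i : Fin n) → lookup x i ≡ true →
                suc (ones (x [ i ]≔ false)) ≡ ones x
ones-[]≔false (true ∷ x) zero    _  = refl
ones-[]≔false (xᵢ ∷ x)   (suc i) eq =
  trans (sym (+-suc _ _)) (cong ((if xᵢ then 1 else 0) +_) (ones-[]≔false x i eq))

[]≔false-≤ᵇ : (x : Vec Bool n) (i : Fin n) → (x [ i ]≔ false) ≤ᵇ x
[]≔false-≤ᵇ (x₀ ∷ x) zero    = Boolₚ.≤-minimum x₀ ∷ Pointwise.refl Boolₚ.≤-refl
[]≔false-≤ᵇ (x₀ ∷ x) (suc i) = Boolₚ.≤-refl ∷ []≔false-≤ᵇ x i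

≤ᵇ-[]≔false : b ≤ᵇ x → ∀ i → lookup b i ≡ false → b ≤ᵇ (x [ i ]≔ false)
≤ᵇ-[]≔false (_ ∷ b≤x) zero    refl = Bool.b≤b ∷ b≤x
≤ᵇ-[]≔false (p ∷ b≤x) (suc i) bᵢ   = p ∷ ≤ᵇ-[]≔false b≤x i bᵢ

<ᵇ⇒∃-false-true : b ≤ᵇ x → b ≢ x → ∃ λ i → lookup b i ≡ false × lookup x i ≡ true
<ᵇ⇒∃-false-true []             b≢x = ⊥-elim (b≢x refl)
<ᵇ⇒∃-false-true (Bool.f≤t ∷ _) _   = zero , refl , refl
<ᵇ⇒∃-false-true (Bool.b≤b ∷ b≤x) b≢x
  with i , bᵢ , xᵢ ← <ᵇ⇒∃-false-true b≤x (b≢x ∘ cong (_ ∷_)) = suc i , bᵢ , xᵢ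

module _ {f : BoolFun n} (mono : Monotone f) where

  Droppable : Vec Bool n → Fin n → Set
  Droppable x i = lookup x i ≡ true × f (x [ i ]≔ false) ≡ true

  Low-if-undroppable : f x ≡ true → ¬ ∃ (Droppable x) → Low f x
  Low-if-undroppable {x} fx≡true undroppable = fx≡true , λ b b≤x b≢x →
    let i , bᵢ , xᵢ = <ᵇ⇒∃-false-true b≤x b≢x
        fx′≡false = Boolₚ.¬-not (λ fx′ → undroppable (i , xᵢ , fx′))
        fb≤false = subst (f b Bool.≤_) fx′≡false (mono b _ (≤ᵇ-[]≔false b≤x i bᵢ))
    in Boolₚ.≤-antisym fb≤false (Boolₚ.≤-minimum _)

  Low-below′ : ∀ x → Acc _<_ (ones x) → f x ≡ true → ∃ λ a → Low f a × a ≤ᵇ x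
  Low-below′ x (acc rec) fx≡true
    with any? (λ i → (lookup x i Bool.≟ true) ×-dec (f (x [ i ]≔ false) Bool.≟ true))
  ... | no undroppable = x , Low-if-undroppable fx≡true undroppable , Pointwise.refl Boolₚ.≤-refl
  ... | yes (i , xᵢ , fx′)
    with a , low , a≤x′ ← Low-below′ (x [ i ]≔ false) (rec (≤-reflexive (ones-[]≔false x i xᵢ))) fx′
    = a , low , Pointwise.trans Boolₚ.≤-trans a≤x′ ([]≔false-≤ᵇ x i)

  Low-below : ∀ x → f x ≡ true → ∃ λ a → Low f a × a ≤ᵇ x
  Low-below x = Low-below′ x (<-wellFounded (ones x))

degree≤k*ones : ∀ k (b : Vec ℕ n) (a : Vec Bool n) → SameSupp b a → (∀ i → lookup b i ≤ k) →
  degree b ≤ k * ones a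
degree≤k*ones k []      []       _    _   = z≤n
degree≤k*ones k (b₀ ∷ b) (a₀ ∷ a) same b≤k = begin
  b₀ + degree b
    ≤⟨ +-mono-≤ (head a₀ (same zero)) (degree≤k*ones k b a (same ∘ suc) (b≤k ∘ suc)) ⟩
  k * (if a₀ then 1 else 0) + k * ones a
    ≡⟨ *-distribˡ-+ k _ (ones a) ⟨
  k * ones (a₀ ∷ a) ∎
  where
  open ≤-Reasoning
  head : ∀ a₀ → (b₀ ≡ 0) ⇔ (a₀ ≡ false) → b₀ ≤ k * (if a₀ then 1 else 0)
  head true  _     = ≤-trans (b≤k zero) (≤-reflexive (sym (*-identityʳ k)))
  head false same₀ = ≤-reflexive (trans (Equivalence.from same₀ refl) (sym (*-zeroʳ k)))

SameSupp-⊨ : (b : Vec ℕ n) → SameSupp b a → a ≤ᵇ x → x ⊨ b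
SameSupp-⊨ {a = a} b same a≤x i xᵢ =
  Equivalence.from (same i) (Boolₚ.≤-antisym aᵢ≤false (Boolₚ.≤-minimum _))
  where
  aᵢ≤false = subst (lookup a i Bool.≤_) xᵢ (Pointwise.lookup a≤x i)

_⊕_ : Monomials n → Monomials n → Monomials n
(S ⊕ T) b = Σ (Vec ℕ _) λ c → Σ (Vec ℕ _) λ d → S c × T d × b ≡ zipWith _+_ c d

⋃< : ℕ → (ℕ → Monomials n) → Monomials n
⋃< M T b = ∃ λ j → j < M × T j b

⋃<-suc : (M : ℕ) (T : ℕ → Monomials n) → ⋃< M T ∪ T M ≐ ⋃< (suc M) T
⋃<-suc M T = (λ { (inj₁ (j , j<M , h)) → j , m<n⇒m<1+n j<M , h ; (inj₂ h) → M , n<1+n M , h })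
           , λ { (j , j<1+M , h) → split (m<1+n⇒m<n∨m≡n j<1+M) h }
  where
  split : ∀ {j b} → j < M ⊎ j ≡ M → T j b → (⋃< M T ∪ T M) b
  split (inj₁ j<M) h = inj₁ (_ , j<M , h)
  split (inj₂ refl) h = inj₂ h

∪-cong : S ≐ S′ → T ≐ T′ → S ∪ T ≐ S′ ∪ T′
∪-cong (S⊆ , ⊇S) (T⊆ , ⊇T) = (λ { (inj₁ h) → inj₁ (S⊆ h) ; (inj₂ h) → inj₂ (T⊆ h) })
                           , (λ { (inj₁ h) → inj₁ (⊇S h) ; (inj₂ h) → inj₂ (⊇T h) })

∪-emptyˡ : ∅ ≐ S → T ≐ S ∪ T
∪-emptyˡ (_ , S⊆∅) = inj₂ , λ { (inj₁ h) → ⊥-elim (S⊆∅ h) ; (inj₂ h) → h }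

∪-emptyʳ : ∅ ≐ T → S ≐ S ∪ T
∪-emptyʳ (_ , T⊆∅) = inj₁ , λ { (inj₁ h) → h ; (inj₂ h) → ⊥-elim (T⊆∅ h) }

⊕-cong : S ≐ S′ → T ≐ T′ → S ⊕ T ≐ S′ ⊕ T′
⊕-cong (S⊆ , ⊇S) (T⊆ , ⊇T) = (λ { (c , d , hc , hd , eq) → c , d , S⊆ hc , T⊆ hd , eq })
                           , (λ { (c , d , hc , hd , eq) → c , d , ⊇S hc , ⊇T hd , eq })

⊕-emptyˡ : ∅ ≐ S → ∅ ≐ S ⊕ T
⊕-emptyˡ (_ , S⊆∅) = (λ ()) , λ { (_ , _ , hc , _) → S⊆∅ hc }

⊕-emptyʳ : ∅ ≐ T → ∅ ≐ S ⊕ T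
⊕-emptyʳ (_ , T⊆∅) = (λ ()) , λ { (_ , _ , _ , hd , _) → T⊆∅ hd }

OfDegree : ℕ → Monomials n
OfDegree d b = degree b ≡ d

DegreeAtMost : ℕ → Monomials n
DegreeAtMost D b = degree b ≤ D

∩-congʳ : S ≐ S′ → S ∩ T ≐ S′ ∩ T
∩-congʳ (S⊆ , ⊇S) = (λ (h , k) → S⊆ h , k) , (λ (h , k) → ⊇S h , k)

∩-distribʳ-∪ : (S T U : Monomials n) → (S ∪ T) ∩ U ≐ (S ∩ U) ∪ (T ∩ U)
∩-distribʳ-∪ S T U = (λ { (inj₁ h , k) → inj₁ (h , k) ; (inj₂ h , k) → inj₂ (h , k) })
                   , (λ { (inj₁ (h , k)) → inj₁ h , k ; (inj₂ (h , k)) → inj₂ h , k })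

⊕-∩-OfDegree : (S T : Monomials n) (d : ℕ) →
  (S ⊕ T) ∩ OfDegree d ≐ ⋃< (suc d) (λ j → (S ∩ OfDegree j) ⊕ (T ∩ OfDegree (d ∸ j)))
⊕-∩-OfDegree S T d =
  (λ { ((c , e , c∈S , e∈T , refl) , deg) →
         let deg′ = trans (sym (degree-zipWith-+ c e)) deg in
         degree c , s≤s (≤-trans (m≤m+n (degree c) (degree e)) (≤-reflexive deg′)) ,
         c , e , (c∈S , refl) ,
         (e∈T , trans (sym (m+n∸m≡n (degree c) (degree e))) (cong (_∸ degree c) deg′)) , refl }) ,
  (λ { (j , j<1+d , c , e , (c∈S , degc) , (e∈T , dege) , refl) →
         (c , e , c∈S , e∈T , refl) ,
         trans (degree-zipWith-+ c e) (trans (cong₂ _+_ degc dege) (m+[n∸m]≡n (≤-pred j<1+d))) })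

DegreeAtMost-⋃< : (S : Monomials n) (D : ℕ) → S ∩ DegreeAtMost D ≐ ⋃< (suc D) (λ d → S ∩ OfDegree d)
DegreeAtMost-⋃< S D = (λ (h , deg≤D) → _ , s≤s deg≤D , h , refl)
                     , (λ { (_ , d<1+D , h , refl) → h , ≤-pred d<1+D })

infix 4 _⊑_

data _⊑_ {n s} (P : SLP n s) : ∀ {t} → SLP n t → Set where
  ⊑-refl : P ⊑ P
  ⊑-step : ∀ {t} {Q : SLP n t} → P ⊑ Q → (g : Gate (t + n)) → P ⊑ Q ▷ g

⊑-trans : P ⊑ Q → Q ⊑ R → P ⊑ R
⊑-trans P⊑Q ⊑-refl         = P⊑Q
⊑-trans P⊑Q (⊑-step Q⊑R g) = ⊑-step (⊑-trans P⊑Q Q⊑R) g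

weaken : {P : SLP n s} {Q : SLP n t} → P ⊑ Q → Fin (s + n) → Fin (t + n)
weaken ⊑-refl       v = v
weaken (⊑-step e g) v = suc (weaken e v)

InB-suc : (P : SLP n s) (g : Gate (s + n)) (v : Fin (s + n)) → InB (P ▷ g) (suc v) ≐ InB P v
InB-suc P (OR  , _) v = ≐-refl
InB-suc P (AND , _) v = ≐-refl

InB-weaken : {P : SLP n s} {Q : SLP n t} (e : P ⊑ Q) (v : Fin (s + n)) → InB Q (weaken e v) ≐ InB P v
InB-weaken ⊑-refl       v = ≐-refl
InB-weaken (⊑-step e g) v = ≐-trans (InB-suc _ g (weaken e v)) (InB-weaken e v)

-- Circuits have no constants, so the empty set is produced by no node: nodes are optional.
⟦_⟧? : SLP n t → Maybe (Fin (t + n)) → Monomials n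
⟦ Q ⟧? nothing  = ∅
⟦ Q ⟧? (just v) = InB Q v

record Node {n t} (Q : SLP n t) (S : Monomials n) : Set where
  constructor node
  field
    position : Maybe (Fin (t + n))
    produces : ⟦ Q ⟧? position ≐ S

Node-cong : S ≐ T → Node Q S → Node Q T
Node-cong S≐T (node p prod) = node p (≐-trans prod S≐T)

Node-weaken : {P : SLP n s} {Q : SLP n t} → P ⊑ Q → Node P S → Node Q S
Node-weaken e (node nothing  prod) = node nothing prod
Node-weaken e (node (just v) prod) = node (just (weaken e v)) (≐-trans (InB-weaken e v) prod)

Node-nonempty : {b : Vec ℕ n} → Node Q S → S b → ∃ λ v → InB Q v ≐ S
Node-nonempty (node nothing  prod) b∈S = ⊥-elim (proj₂ prod b∈S)
Node-nonempty (node (just v) prod) _   = v , prod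

record Extension {n s} (P : SLP n s) (c : ℕ) (A : ∀ {t} → SLP n t → Set) : Set where
  constructor extension
  field
    {size′}  : ℕ
    program  : SLP n size′
    extends  : P ⊑ program
    cost     : size′ ≤ s + c
    result   : A program

no-gates : A P → Extension P 0 A
no-gates {P = P} x = extension P ⊑-refl (≤-reflexive (sym (+-identityʳ _))) x

relax : c ≤ c′ → Extension P c A → Extension P c′ A
relax c≤c′ (extension Q e cost x) = extension Q e (≤-trans cost (+-monoʳ-≤ _ c≤c′)) x

Extension-map : (∀ {t} {Q : SLP n t} → P ⊑ Q → A Q → A′ Q) → Extension P c A → Extension P c A′
Extension-map f (extension Q e cost x) = extension Q e cost (f e x)

bind : {P : SLP n s} → Extension P c A →
       (∀ {t} {Q : SLP n t} → P ⊑ Q → A Q → Extension Q c′ A′) → Extension P (c + c′) A′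
bind {s = s} {c = c} {c′ = c′} (extension Q e cost x) next
  with extension R e′ cost′ y ← next e x =
  extension R (⊑-trans e e′) (≤-trans cost′ (≤-trans (+-monoˡ-≤ c′ cost) (≤-reflexive (+-assoc s c c′)))) y

NodeFor : Monomials n → SLP n t → Set
NodeFor S Q = Node Q S

new-gate : (P : SLP n s) (g : Gate (s + n)) → Extension P 1 (NodeFor (InB (P ▷ g) zero))
new-gate {s = s} P g =
  extension (P ▷ g) (⊑-step ⊑-refl g) (≤-reflexive (+-comm 1 s)) (node (just zero) ≐-refl)

∪-node : Node P S → Node P T → Extension P 1 (NodeFor (S ∪ T))
∪-node (node nothing ∅≐S) nodeT              = relax z≤n (no-gates (Node-cong (∪-emptyˡ ∅≐S) nodeT))
∪-node nodeS              (node nothing ∅≐T) = relax z≤n (no-gates (Node-cong (∪-emptyʳ ∅≐T) nodeS))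
∪-node {P = P} (node (just u) prodS) (node (just w) prodT) =
  Extension-map (λ _ → Node-cong (∪-cong prodS prodT)) (new-gate P (OR , u , w))

⊕-node : Node P S → Node P T → Extension P 1 (NodeFor (S ⊕ T))
⊕-node (node nothing ∅≐S) _                  = relax z≤n (no-gates (node nothing (⊕-emptyˡ ∅≐S)))
⊕-node (node (just _) _)  (node nothing ∅≐T) = relax z≤n (no-gates (node nothing (⊕-emptyʳ ∅≐T)))
⊕-node {P = P} (node (just u) prodS) (node (just w) prodT) =
  Extension-map (λ _ → Node-cong (⊕-cong prodS prodT)) (new-gate P (AND , u , w))

Buildable : SLP n s → ℕ → Monomials n → Set
Buildable {n} P c S = ∀ {t} {Q : SLP n t} → P ⊑ Q → Extension Q c (NodeFor S)

⋃<-node : (M : ℕ) (T : ℕ → Monomials n) → (∀ j → j < M → Buildable P c (T j)) →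
          Extension P (M * suc c) (NodeFor (⋃< M T))
⋃<-node zero    T build = no-gates (node nothing ((λ ()) , λ { (_ , () , _) }))
⋃<-node {c = c} (suc M) T build = relax (≤-reflexive cost-eq) (
  bind (⋃<-node M T (λ j j<M → build j (m<n⇒m<1+n j<M))) λ e nodeU →
  bind (build M (n<1+n M) e) λ e′ nodeT →
  Extension-map (λ _ → Node-cong (⋃<-suc M T)) (∪-node (Node-weaken e′ nodeU) nodeT))
  where
  cost-eq : M * suc c + (c + 1) ≡ suc M * suc c
  cost-eq = trans (+-comm (M * suc c) (c + 1)) (cong (_+ M * suc c) (+-comm c 1))

Table : (ℕ → Monomials n) → ℕ → SLP n t → Set
Table T M Q = ∀ d → d < M → Node Q (T d)

Table-weaken : {T : ℕ → Monomials n} {M : ℕ} {P : SLP n s} {Q : SLP n t} →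
               P ⊑ Q → Table T M P → Table T M Q
Table-weaken e tab d d<M = Node-weaken e (tab d d<M)

tabulate-nodes : (M : ℕ) (T : ℕ → Monomials n) → (∀ d → d < M → Buildable P c (T d)) →
                 Extension P (M * c) (Table T M)
tabulate-nodes zero    T build = no-gates (λ _ ())
tabulate-nodes {c = c} (suc M) T build = relax (≤-reflexive (+-comm (M * c) c)) (
  bind (tabulate-nodes M T (λ d d<M → build d (m<n⇒m<1+n d<M))) λ e tab →
  Extension-map (λ e′ nodeT → snoc (Table-weaken e′ tab) nodeT) (build M (n<1+n M) e))
  where
  snoc : ∀ {t} {Q : SLP _ t} → Table T M Q → Node Q (T M) → Table T (suc M) Q
  snoc tab nodeT d d<1+M with m<1+n⇒m<n∨m≡n d<1+M
  ... | inj₁ d<M = tab d d<M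
  ... | inj₂ refl = nodeT

variable-part : (i : Fin n) (d : ℕ) → Node [] (InB [] i ∩ OfDegree d)
variable-part i d with d ℕ.≟ 1
... | yes refl = node (just i) ((λ h → h , trans (cong degree h) (degree-unit i)) , proj₁)
... | no d≢1   = node nothing ((λ ()) , λ { (refl , deg) → d≢1 (trans (sym deg) (degree-unit i)) })

-- For each of the D + 1 degrees, at most D + 1 ∧-gates and as many ∨-gates.
cost-per-gate : ℕ → ℕ
cost-per-gate D = suc D * (suc D * 2)

module _ (D : ℕ) where

  Homogenised : SLP n s → SLP n t → Set
  Homogenised P Q = ∀ v → Table (λ d → InB P v ∩ OfDegree d) (suc D) Q

  gate-part : (P : SLP n s) (g : Gate (s + n)) → Homogenised P Q →
              ∀ d → d < suc D → Buildable Q (suc D * 2) (InB (P ▷ g) zero ∩ OfDegree d)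
  gate-part P (OR , l , r) H d d<1+D e =
    relax (s≤s z≤n) (Extension-map (λ _ → Node-cong (≐-sym (∩-distribʳ-∪ _ _ _)))
      (∪-node (Node-weaken e (H l d d<1+D)) (Node-weaken e (H r d d<1+D))))
  gate-part P (AND , l , r) H d d<1+D e =
    relax (*-monoˡ-≤ 2 d<1+D) (Extension-map (λ _ → Node-cong (≐-sym (⊕-∩-OfDegree _ _ d)))
      (⋃<-node (suc d) _ λ j j<1+d e′ →
        ⊕-node (Node-weaken (⊑-trans e e′) (H l j (≤-trans j<1+d d<1+D)))
               (Node-weaken (⊑-trans e e′) (H r (d ∸ j) (≤-<-trans (m∸n≤m d j) d<1+D)))))

  Homogenised-▷ : (P : SLP n s) (g : Gate (s + n)) → Homogenised P Q →
                  Table (λ d → InB (P ▷ g) zero ∩ OfDegree d) (suc D) Q → Homogenised (P ▷ g) Q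
  Homogenised-▷ P g H tab zero    = tab
  Homogenised-▷ P g H tab (suc v) d d<1+D = Node-cong (∩-congʳ (≐-sym (InB-suc P g v))) (H v d d<1+D)

  homogenise : (P : SLP n s) → Extension [] (s * cost-per-gate D) (Homogenised P)
  homogenise []                  = no-gates (λ i d _ → variable-part i d)
  homogenise {s = suc s} (P ▷ g) =
    relax (≤-reflexive (+-comm (s * cost-per-gate D) (cost-per-gate D))) (
    bind (homogenise P) λ _ H →
    Extension-map (λ e tab → Homogenised-▷ P g (λ v → Table-weaken e (H v)) tab)
      (tabulate-nodes (suc D) _ (gate-part P g H)))

truncated-node : (D : ℕ) (P : SLP n s) (v : Fin (s + n)) →
                 Extension [] (s * cost-per-gate D + suc D) (NodeFor (InB P v ∩ DegreeAtMost D))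
truncated-node {s = s} D P v =
  relax (≤-reflexive (cong (s * cost-per-gate D +_) (*-identityʳ (suc D)))) (
  bind (homogenise D P) λ _ H →
  Extension-map (λ _ → Node-cong (≐-sym (DegreeAtMost-⋃< _ D)))
    (⋃<-node (suc D) _ λ d d<1+D e → no-gates (Node-weaken e (H v d d<1+D))))

degree-truncation : (D : ℕ) (F : Circuit n) {b₀ : Vec ℕ n} → B F b₀ → degree b₀ ≤ D →
  ∃ λ (H : Circuit n) → size H ≤ size F * cost-per-gate D + suc D × B H ≐ B F ∩ DegreeAtMost D
degree-truncation D (circuit s P out) b₀∈F deg≤D
  with extension Q _ cost nodeH ← truncated-node D P out
  with w , prod ← Node-nonempty nodeH (b₀∈F , deg≤D)
  = circuit _ Q w , cost , prod

Computes-⊆ : (F H : Circuit n) → Monotone f → Computes F f → B H ⊆ B F → ReadK k H f →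
             Computes H f
Computes-⊆ {f = f} F H mono F-computes H⊆F readK x with f x in fx
... | true
  with a , low , a≤x ← Low-below mono x fx
  with b , b∈H , same , _ ← readK a low
  = InB⇒eval≡true (prog H) x (output H) b∈H (SameSupp-⊨ b same a≤x)
... | false with eval (prog H) x (output H) in Hx
...   | false = refl
...   | true
  with b , b∈H , x⊨b ← eval≡true⇒∃InB (prog H) x (output H) Hx
  with () ← trans (sym (trans (sym (F-computes x)) (InB⇒eval≡true (prog F) x (output F) (H⊆F b∈H) x⊨b)))
                  fx

low-witness-degree : (∀ a → Low f a → ones a ≤ m) → Low f a → (b : Vec ℕ n) → SameSupp b a →
                     (∀ i → lookup b i ≤ k) → degree b ≤ k * m
low-witness-degree {a = a} {k = k} ones≤m low b same b≤k =
  ≤-trans (degree≤k*ones k b a same b≤k) (*-monoʳ-≤ k (ones≤m a low))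

ReadK-⊆ : (F H : Circuit n) → (∀ a → Low f a → ones a ≤ m) → ReadK k F f →
          B F ∩ DegreeAtMost (k * m) ⊆ B H → ReadK k H f
ReadK-⊆ F H ones≤m readK F∩D⊆H a low with b , b∈F , same , b≤k ← readK a low =
  b , F∩D⊆H (b∈F , low-witness-degree ones≤m low b same b≤k) , same , b≤k

size-bound : ∀ s D → 1 ≤ D → suc s * cost-per-gate D + suc D ≤ suc s * (10 * (D * D))
size-bound s D@(suc E) _ = begin
  suc s * cost-per-gate D + suc D          ≤⟨ +-monoʳ-≤ (suc s * cost-per-gate D) (m≤n*m (suc D) (suc s)) ⟩
  suc s * cost-per-gate D + suc s * suc D  ≡⟨ *-distribˡ-+ (suc s) (cost-per-gate D) (suc D) ⟨
  suc s * (cost-per-gate D + suc D)        ≤⟨ *-monoʳ-≤ (suc s) (m≤m+n _ (8 * (E * E) + 11 * E)) ⟩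
  suc s * (cost-per-gate D + suc D + (8 * (E * E) + 11 * E)) ≡⟨ cong (suc s *_) (expand E) ⟩
  suc s * (10 * (D * D))                   ∎
  where
  open ≤-Reasoning
  expand : ∀ E → (2 + E) * ((2 + E) * 2) + (2 + E) + (8 * (E * E) + 11 * E) ≡ 10 * ((1 + E) * (1 + E))
  expand = solve-∀

bounded-degree-circuit : (F : Circuit n) → Monotone f → Computes F f → ReadK k F f →
  (∀ a → Low f a → ones a ≤ m) → {b₀ : Vec ℕ n} → B F b₀ → degree b₀ ≤ k * m →
  ∃ λ (H : Circuit n) → Computes H f × ReadK k H f ×
    size H ≤ size F * (10 * (k * m * (k * m))) × (∀ b → B H b → degree b ≤ k * m)
-- Without gates F is a single variable; truncation would add output gates, so F is kept.
bounded-degree-circuit F@(circuit zero [] out) _ F-computes readK _ b₀∈F deg₀ =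
  F , F-computes , readK , z≤n , λ b b∈F → subst (λ c → degree c ≤ _) (trans b₀∈F (sym b∈F)) deg₀
bounded-degree-circuit {k = k} {m = m} F@(circuit (suc s) P out) mono F-computes readK ones≤m
                       b₀∈F deg₀
  with H , size-H , H⊆F , F∩D⊆H ← degree-truncation (k * m) F b₀∈F deg₀
  = H , Computes-⊆ F H mono F-computes (proj₁ ∘ H⊆F) readK-H , readK-H ,
    ≤-trans size-H (size-bound s (k * m) (≤-trans (1≤degree-InB P out b₀∈F) deg₀)) ,
    λ _ → proj₂ ∘ H⊆F
  where
  readK-H : ReadK k H _
  readK-H = ReadK-⊆ F H ones≤m readK F∩D⊆H

lemma2 : ∃ λ (c : ℕ) →
    ∀ (n : ℕ) (f : BoolFun n) (m k : ℕ) (F : Circuit n) →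
    Monotone f → NonConstant f → MaxPrimeImplicantSize f m →
    Computes F f → ReadK k F f →
    ∃ λ (H : Circuit n) →
      Computes H f × ReadK k H f ×
      size H ≤ size F * (c * (k * k * (m * m))) ×
      (∀ (b : Vec ℕ n) → B H b → degree b ≤ k * m)
lemma2 = 10 , λ n f m k F mono ((x₀ , fx₀) , _) (_ , ones≤m) F-computes readK →
  let a₀ , low₀ , _ = Low-below mono x₀ fx₀
      b₀ , b₀∈F , same₀ , b₀≤k = readK a₀ low₀
      H , H-computes , H-readK , size-H , degree-H =
        bounded-degree-circuit F mono F-computes readK ones≤m
          b₀∈F (low-witness-degree ones≤m low₀ b₀ same₀ b₀≤k)
  in H , H-computes , H-readK , subst (λ q → size H ≤ size F * (10 * q)) (square k m) size-H , degree-H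
  where
  square : ∀ k m → k * m * (k * m) ≡ k * k * (m * m)
  square = solve-∀
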